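{- Let $\mathbb{F}_q^{2}$ be the $2$-dimensional classical space with parameter $e$ ($\nu=1$). Every $(1,0)$-spread in $\mathbb{F}_q^2$ is of type I, i.e. of the form $\{P+x: x\in\mathbb{F}_q^2\}$ for a single $1$-dimensional totally isotropic subspace $P$.
   Context: $q$ is a prime power and $e\in\{1,1/2,0\}$. The classical space is one of: - symplectic ($e=1$), with form matrix $\begin{pmatrix}0&1\\-1&0\end{pmatrix}$; - unitary ($e=1/2$), with $q=q_0^2$, $\bar a=a^{q_0}$ and Hermitian form matrix $\begin{pmatrix}0&1\\1&0\end{pmatrix}$; - orthogonal ($e=0$), with $q$ odd and symmetric form matrix $\begin{pmatrix}0&1\\1&0\end{pmatrix}$. A $(1,0)$-flat is a coset $P+x$ of a $1$-dimensional totally isotropic subspace $P$. A $(1,0)$-spread in $\mathbb{F}_q^2$ is a set of pairwise disjoint $(1,0)$-flats partitioning $\mathbb{F}_q^2$. -}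

module Defs where

open import Level using (Level; _⊔_) renaming (suc to lsuc)
open import Data.Nat using (ℕ) renaming (_*_ to _*ℕ_)
open import Data.Nat.Divisibility using (_∣_)
open import Data.Fin using (Fin)
open import Data.Product using (Σ; ∃; _×_; _,_)
open import Relation.Binary.PropositionalEquality using (_≡_)
open import Relation.Nullary using (¬_)
import Data.Empty
open import Algebra.Bundles using (CommutativeRing)
import Algebra.Bundles
import Algebra.Definitions.RawSemiring as RawSR

record IsField {c ℓ : Level} (R : CommutativeRing c ℓ) : Set (c ⊔ ℓ) where
  open CommutativeRing R
  field
    1≉0 : ¬ (1# ≈ 0#)
    inverse : ∀ a → ¬ (a ≈ 0#) → ∃ λ b → a * b ≈ 1#

record FiniteField (c ℓ : Level) : Set (lsuc (c ⊔ ℓ)) where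
  field
    cring   : CommutativeRing c ℓ
    isField : IsField cring
  open CommutativeRing cring public
  field
    card       : ℕ
    enum       : Fin card → Carrier
    enum-surj  : ∀ a → ∃ λ i → enum i ≈ a
    enum-inj   : ∀ i j → enum i ≈ enum j → i ≡ j

  open RawSR (Algebra.Bundles.Semiring.rawSemiring semiring) public using (_^_)

data Kind {c ℓ : Level} (F : FiniteField c ℓ) : Set where
  -- e = 1
  symplectic : Kind F
  -- e = 1/2 : q = q₀², conjugation a ↦ a ^ q₀
  unitary    : (q₀ : ℕ) → FiniteField.card F ≡ q₀ *ℕ q₀ → Kind F
  -- e = 0 : q odd
  orthogonal : ¬ (2 ∣ FiniteField.card F) → Kind F

module Space {c ℓ : Level} (F : FiniteField c ℓ) where
  open FiniteField F

  V : Set c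
  V = Carrier × Carrier

  _≈V_ : V → V → Set ℓ
  (a , b) ≈V (a' , b') = (a ≈ a') × (b ≈ b')

  _+V_ : V → V → V
  (a , b) +V (a' , b') = (a + a' , b + b')

  _·V_ : Carrier → V → V
  k ·V (a , b) = (k * a , k * b)

  0V : V
  0V = (0# , 0#)

  -- the form f(u , v) = u K vbar^T, with K the matrix of the context
  form : Kind F → V → V → Carrier
  -- K = [[0,1],[-1,0]] : u₁v₂ − u₂v₁
  form symplectic         (u₁ , u₂) (v₁ , v₂) = (u₁ * v₂) + (- (u₂ * v₁))
  -- K = [[0,1],[1,0]] Hermitian : u₁ v̄₂ + u₂ v̄₁ with ā = a ^ q₀
  form (unitary q₀ _)     (u₁ , u₂) (v₁ , v₂) = (u₁ * (v₂ ^ q₀)) + (u₂ * (v₁ ^ q₀))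
  -- K = [[0,1],[1,0]] symmetric : u₁v₂ + u₂v₁
  form (orthogonal _)     (u₁ , u₂) (v₁ , v₂) = (u₁ * v₂) + (u₂ * v₁)

  Subset : Set (lsuc (c ⊔ ℓ))
  Subset = V → Set (c ⊔ ℓ)

  _≐_ : Subset → Subset → Set (c ⊔ ℓ)
  S ≐ T = ∀ z → (S z → T z) × (T z → S z)

  record IsSubspace (P : Subset) : Set (c ⊔ ℓ) where
    field
      resp : ∀ {u v} → u ≈V v → P u → P v
      zero∈ : P 0V
      +∈ : ∀ {u v} → P u → P v → P (u +V v)
      ·∈ : ∀ k {u} → P u → P (k ·V u)

  Is1Dim : Subset → Set (c ⊔ ℓ)
  Is1Dim P = IsSubspace P × ∃ λ p → ¬ (p ≈V 0V) × P p × (∀ u → P u → ∃ λ a → u ≈V (a ·V p))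

  TotIsotropic : Kind F → Subset → Set (c ⊔ ℓ)
  TotIsotropic k P = ∀ u v → P u → P v → form k u v ≈ 0#

  coset : Subset → V → Subset
  coset P x z = ∃ λ u → P u × (z ≈V (u +V x))

  Is10Flat : Kind F → Subset → Set (lsuc (c ⊔ ℓ))
  Is10Flat k S = ∃ λ (P : Subset) → Is1Dim P × TotIsotropic k P × ∃ λ x → S ≐ coset P x

  -- A (1,0)-spread: a set of flats, given as a family indexed by I with distinct
  -- indices naming distinct (indeed disjoint) flats, partitioning V.
  record Is10Spread {i : Level} (k : Kind F) {I : Set i} (S : I → Subset) : Set (lsuc (c ⊔ ℓ) ⊔ i) where
    field
      flat     : ∀ j → Is10Flat k (S j)
      disjoint : ∀ j j' → ¬ (j ≡ j') → ∀ z → S j z → S j' z → Data.Empty.⊥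
      cover    : ∀ z → ∃ λ j → S j z

-- Let P + x₀ be the flat of the spread through the origin, P = ⟨p⟩. A flat Q + y
-- with Q = ⟨q⟩ and q not parallel to p meets P + x₀ (Cramer's rule, det(p, q) ≠ 0),
-- so by disjointness it is the same flat; but then y and y + q both lie on P + x₀,
-- forcing q ∈ P, a contradiction. Hence every flat is a coset of P, and a coset
-- P + x' containing x equals P + x, so every coset of P occurs.
module Submission where

open import Defs
open import Level using (Level)
open import Data.Product using (∃; ∃₂; _×_; _,_; proj₁; proj₂; uncurry)
open import Function.Base using (_∘_)
open import Data.Empty using (⊥; ⊥-elim)
open import Relation.Nullary using (¬_; Dec; yes; no)
open import Relation.Nullary.Decidable using (map′)
import Data.Fin.Properties as Fin
import Relation.Binary.PropositionalEquality as ≡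
open import Algebra.Bundles using (CommutativeRing)
open import Data.Nat.Base as ℕ using (zero; suc)
open import Data.Integer.Base as ℤ using (ℤ; +_; -[1+_]; sign; ∣_∣; _◃_; _⊖_)
import Data.Integer.Properties as ℤ
import Data.Nat.Properties as ℕ
open import Data.Sign.Base as Sign using (Sign)
open import Data.Maybe.Base using (Maybe; just; nothing)
open import Algebra.Solver.Ring.AlmostCommutativeRing
  using (fromCommutativeRing; _-Raw-AlmostCommutative⟶_)

-- The library's ring solver needs coefficients whose arithmetic computes; ℤ maps
-- into every commutative ring, so it serves as the coefficient ring.
module CommutativeRingSolver {c ℓ : Level} (R : CommutativeRing c ℓ) where
  open CommutativeRing R
  open import Algebra.Properties.Semiring.Mult.TCOptimised semiring using (1+×; ×-homo-+; ×1-homo-*)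
    renaming (_×_ to _×′_)
  open import Algebra.Properties.Ring ring using (-1*x≈-x)
  open import Algebra.Properties.AbelianGroup +-abelianGroup using (⁻¹-∙-comm)
  open import Algebra.Properties.Group +-group using (ε⁻¹≈ε; ⁻¹-involutive)
  open import Algebra.Properties.CommutativeSemigroup +-commutativeSemigroup
    using () renaming (interchange to +-interchange)
  open import Algebra.Properties.CommutativeSemigroup *-commutativeSemigroup
    using () renaming (interchange to *-interchange)
  open import Relation.Binary.Reasoning.Setoid setoid

  ⟦_⟧ : ℤ → Carrier
  ⟦ + n ⟧      = n ×′ 1#
  ⟦ -[1+ n ] ⟧ = - (suc n ×′ 1#)

  ⟦⊖⟧ : ∀ m n → ⟦ m ⊖ n ⟧ ≈ m ×′ 1# - n ×′ 1#
  ⟦⊖⟧ m       zero    = trans (sym (+-identityʳ _)) (+-congˡ (sym ε⁻¹≈ε))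
  ⟦⊖⟧ zero    (suc n) = sym (+-identityˡ _)
  ⟦⊖⟧ (suc m) (suc n) = begin
    ⟦ suc m ⊖ suc n ⟧                  ≡⟨ ≡.cong ⟦_⟧ (ℤ.[1+m]⊖[1+n]≡m⊖n m n) ⟩
    ⟦ m ⊖ n ⟧                          ≈⟨ ⟦⊖⟧ m n ⟩
    m ×′ 1# - n ×′ 1#                  ≈⟨ +-identityˡ _ ⟨
    0# + (m ×′ 1# - n ×′ 1#)           ≈⟨ +-congʳ (-‿inverseʳ 1#) ⟨
    (1# - 1#) + (m ×′ 1# - n ×′ 1#)    ≈⟨ +-interchange 1# (- 1#) (m ×′ 1#) (- (n ×′ 1#)) ⟩
    (1# + m ×′ 1#) + (- 1# - n ×′ 1#)  ≈⟨ +-congˡ (⁻¹-∙-comm 1# (n ×′ 1#)) ⟩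
    (1# + m ×′ 1#) - (1# + n ×′ 1#)    ≈⟨ +-cong (1+× m 1#) (-‿cong (1+× n 1#)) ⟨
    suc m ×′ 1# - suc n ×′ 1#          ∎

  +-homo : ∀ i j → ⟦ i ℤ.+ j ⟧ ≈ ⟦ i ⟧ + ⟦ j ⟧
  +-homo (+ m)    (+ n)    = ×-homo-+ 1# m n
  +-homo (+ m)    -[1+ n ] = ⟦⊖⟧ m (suc n)
  +-homo -[1+ m ] (+ n)    = trans (⟦⊖⟧ n (suc m)) (+-comm _ _)
  +-homo -[1+ m ] -[1+ n ] = begin
    - (suc (suc (m ℕ.+ n)) ×′ 1#)      ≡⟨ ≡.cong (λ k → - (k ×′ 1#)) (≡.sym (ℕ.+-suc (suc m) n)) ⟩
    - ((suc m ℕ.+ suc n) ×′ 1#)        ≈⟨ -‿cong (×-homo-+ 1# (suc m) (suc n)) ⟩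
    - (suc m ×′ 1# + suc n ×′ 1#)      ≈⟨ ⁻¹-∙-comm _ _ ⟨
    - (suc m ×′ 1#) + - (suc n ×′ 1#)  ∎

  σ : Sign → Carrier
  σ Sign.+ = 1#
  σ Sign.- = - 1#

  σ-homo : ∀ s t → σ (s Sign.* t) ≈ σ s * σ t
  σ-homo Sign.+ t      = sym (*-identityˡ _)
  σ-homo Sign.- Sign.+ = sym (*-identityʳ _)
  σ-homo Sign.- Sign.- = sym (trans (-1*x≈-x (- 1#)) (⁻¹-involutive 1#))

  ⟦◃⟧ : ∀ s n → ⟦ s ◃ n ⟧ ≈ σ s * (n ×′ 1#)
  ⟦◃⟧ s      zero    = sym (zeroʳ (σ s))
  ⟦◃⟧ Sign.+ (suc n) = sym (*-identityˡ _)
  ⟦◃⟧ Sign.- (suc n) = sym (-1*x≈-x _)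

  ⟦⟧-sign-abs : ∀ i → ⟦ i ⟧ ≈ σ (sign i) * (∣ i ∣ ×′ 1#)
  ⟦⟧-sign-abs i = trans (reflexive (≡.cong ⟦_⟧ (≡.sym (ℤ.◃-inverse i)))) (⟦◃⟧ (sign i) ∣ i ∣)

  *-homo : ∀ i j → ⟦ i ℤ.* j ⟧ ≈ ⟦ i ⟧ * ⟦ j ⟧
  *-homo i j = begin
    ⟦ sign i Sign.* sign j ◃ ∣ i ∣ ℕ.* ∣ j ∣ ⟧                 ≈⟨ ⟦◃⟧ (sign i Sign.* sign j) (∣ i ∣ ℕ.* ∣ j ∣) ⟩
    σ (sign i Sign.* sign j) * ((∣ i ∣ ℕ.* ∣ j ∣) ×′ 1#)       ≈⟨ *-cong (σ-homo (sign i) (sign j)) (×1-homo-* ∣ i ∣ ∣ j ∣) ⟩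
    σ (sign i) * σ (sign j) * ((∣ i ∣ ×′ 1#) * (∣ j ∣ ×′ 1#))  ≈⟨ *-interchange _ _ _ _ ⟩
    σ (sign i) * (∣ i ∣ ×′ 1#) * (σ (sign j) * (∣ j ∣ ×′ 1#))  ≈⟨ *-cong (⟦⟧-sign-abs i) (⟦⟧-sign-abs j) ⟨
    ⟦ i ⟧ * ⟦ j ⟧                                              ∎

  -‿homo : ∀ i → ⟦ ℤ.- i ⟧ ≈ - ⟦ i ⟧
  -‿homo -[1+ n ]    = sym (⁻¹-involutive _)
  -‿homo (+ zero)    = sym ε⁻¹≈ε
  -‿homo (+ (suc n)) = refl

  ℤ-morphism : ℤ.+-*-rawRing -Raw-AlmostCommutative⟶ fromCommutativeRing R
  ℤ-morphism = record
    { ⟦_⟧ = ⟦_⟧ ; +-homo = +-homo ; *-homo = *-homo ; -‿homo = -‿homo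
    ; 0-homo = refl ; 1-homo = refl }

  ℤ-coeff≟ : ∀ i j → Maybe (⟦ i ⟧ ≈ ⟦ j ⟧)
  ℤ-coeff≟ i j with i ℤ.≟ j
  ... | yes ≡.refl = just refl
  ... | no _       = nothing

  open import Algebra.Solver.Ring ℤ.+-*-rawRing (fromCommutativeRing R) ℤ-morphism
    ℤ-coeff≟ public using (solve; _:=_; _:+_; _:*_; :-_; _:-_; con)

module Plane {c ℓ : Level} (F : FiniteField c ℓ) where
  open FiniteField F
  open IsField isField
  open Space F
  open import Algebra.Properties.Group +-group using (x∙y⁻¹≈ε⇒x≈y)
  open import Relation.Binary.Reasoning.Setoid setoid
  open CommutativeRingSolver cring

  -- The only use of the finiteness of F.
  ≈-dec : ∀ a b → Dec (a ≈ b)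
  ≈-dec a b with enum-surj a | enum-surj b
  ... | i , eᵢ | j , eⱼ = map′
    (λ { ≡.refl → trans (sym eᵢ) eⱼ })
    (λ a≈b → enum-inj i j (trans eᵢ (trans a≈b (sym eⱼ))))
    (i Fin.≟ j)

  ≈V-sym : ∀ {u v} → u ≈V v → v ≈V u
  ≈V-sym (e₁ , e₂) = sym e₁ , sym e₂

  Parallel : V → V → Set ℓ
  Parallel (p₁ , p₂) (q₁ , q₂) = p₁ * q₂ ≈ p₂ * q₁

  Parallel-sym : ∀ {p q} → Parallel p q → Parallel q p
  Parallel-sym {p₁ , p₂} {q₁ , q₂} pq = trans (*-comm q₁ p₂) (trans (sym pq) (*-comm p₁ q₂))

  Parallel? : ∀ p q → Dec (Parallel p q)
  Parallel? (p₁ , p₂) (q₁ , q₂) = ≈-dec (p₁ * q₂) (p₂ * q₁)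

  multiple⇒Parallel : ∀ {p q} a → q ≈V (a ·V p) → Parallel p q
  multiple⇒Parallel {p₁ , p₂} {q₁ , q₂} a (e₁ , e₂) = begin
    p₁ * q₂        ≈⟨ *-congˡ e₂ ⟩
    p₁ * (a * p₂)  ≈⟨ solve 3 (λ p₁ p₂ a → p₁ :* (a :* p₂) := p₂ :* (a :* p₁)) refl p₁ p₂ a ⟩
    p₂ * (a * p₁)  ≈⟨ *-congˡ (sym e₁) ⟩
    p₂ * q₁        ∎

  Parallel⇒multiple-of-first : ∀ {p q} → ¬ (proj₁ p ≈ 0#) → Parallel p q →
                               ∃ λ a → q ≈V (a ·V p)
  Parallel⇒multiple-of-first {p₁ , p₂} {q₁ , q₂} p₁≉0 pq with inverse p₁ p₁≉0
  ... | i , p₁i≈1 = q₁ * i , first , second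
    where
    scale : ∀ x → x ≈ x * (p₁ * i)
    scale x = trans (sym (*-identityʳ x)) (*-congˡ (sym p₁i≈1))

    first : q₁ ≈ q₁ * i * p₁
    first = trans (scale q₁) (solve 3 (λ q₁ p₁ i → q₁ :* (p₁ :* i) := q₁ :* i :* p₁) refl q₁ p₁ i)

    second : q₂ ≈ q₁ * i * p₂
    second = begin
      q₂             ≈⟨ scale q₂ ⟩
      q₂ * (p₁ * i)  ≈⟨ solve 3 (λ q₂ p₁ i → q₂ :* (p₁ :* i) := p₁ :* q₂ :* i) refl q₂ p₁ i ⟩
      p₁ * q₂ * i    ≈⟨ *-congʳ pq ⟩
      p₂ * q₁ * i    ≈⟨ solve 3 (λ p₂ q₁ i → p₂ :* q₁ :* i := q₁ :* i :* p₂) refl p₂ q₁ i ⟩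
      q₁ * i * p₂    ∎

  Parallel⇒multiple : ∀ {p q} → ¬ (p ≈V 0V) → Parallel p q → ∃ λ a → q ≈V (a ·V p)
  Parallel⇒multiple {p₁ , p₂} {q₁ , q₂} p≉0 pq with ≈-dec p₁ 0#
  ... | no p₁≉0 = Parallel⇒multiple-of-first p₁≉0 pq
  ... | yes p₁≈0 with ≈-dec p₂ 0#
  ...   | yes p₂≈0 = ⊥-elim (p≉0 (p₁≈0 , p₂≈0))
  ...   | no p₂≉0 with Parallel⇒multiple-of-first {p₂ , p₁} {q₂ , q₁} p₂≉0 (sym pq)
  ...     | a , e₂ , e₁ = a , e₁ , e₂

  det : V → V → Carrier
  det (p₁ , p₂) (q₁ , q₂) = p₁ * q₂ - p₂ * q₁

  ¬Parallel⇒det-invertible : ∀ {p q} → ¬ Parallel p q → ∃ λ e → det p q * e ≈ 1#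
  ¬Parallel⇒det-invertible {p₁ , p₂} {q₁ , q₂} ¬pq =
    inverse _ (λ det≈0 → ¬pq (x∙y⁻¹≈ε⇒x≈y (p₁ * q₂) (p₂ * q₁) det≈0))

  -- Cramer's rule det(d, q) p - det(d, p) q = det(p, q) d, coordinatewise and scaled by e.
  cramer₁ : ∀ d₁ d₂ p₁ p₂ q₁ q₂ e →
            (d₁ * q₂ - q₁ * d₂) * e * p₁ ≈ (p₂ * d₁ - p₁ * d₂) * e * q₁ + d₁ * ((p₁ * q₂ - p₂ * q₁) * e)
  cramer₁ = solve 7 (λ d₁ d₂ p₁ p₂ q₁ q₂ e →
    (d₁ :* q₂ :- q₁ :* d₂) :* e :* p₁ := (p₂ :* d₁ :- p₁ :* d₂) :* e :* q₁ :+ d₁ :* ((p₁ :* q₂ :- p₂ :* q₁) :* e)) refl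

  cramer₂ : ∀ d₁ d₂ p₁ p₂ q₁ q₂ e →
            (d₁ * q₂ - q₁ * d₂) * e * p₂ ≈ (p₂ * d₁ - p₁ * d₂) * e * q₂ + d₂ * ((p₁ * q₂ - p₂ * q₁) * e)
  cramer₂ = solve 7 (λ d₁ d₂ p₁ p₂ q₁ q₂ e →
    (d₁ :* q₂ :- q₁ :* d₂) :* e :* p₂ := (p₂ :* d₁ :- p₁ :* d₂) :* e :* q₂ :+ d₂ :* ((p₁ :* q₂ :- p₂ :* q₁) :* e)) refl

  det-invertible⇒lines-meet : ∀ {p q e} → det p q * e ≈ 1# → ∀ x y →
                              ∃₂ λ s t → ((s ·V p) +V x) ≈V ((t ·V q) +V y)
  det-invertible⇒lines-meet {p₁ , p₂} {q₁ , q₂} {e} De≈1 (x₁ , x₂) (y₁ , y₂) =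
      (d₁ * q₂ - q₁ * d₂) * e , (p₂ * d₁ - p₁ * d₂) * e
    , meet x₁ y₁ (cramer₁ d₁ d₂ p₁ p₂ q₁ q₂ e) , meet x₂ y₂ (cramer₂ d₁ d₂ p₁ p₂ q₁ q₂ e)
    where
    d₁ = y₁ - x₁
    d₂ = y₂ - x₂

    meet : ∀ {a b} x y → a ≈ b + (y - x) * (det (p₁ , p₂) (q₁ , q₂) * e) → a + x ≈ b + y
    meet {a} {b} x y a≈ = begin
      a + x                                            ≈⟨ +-congʳ a≈ ⟩
      b + (y - x) * (det (p₁ , p₂) (q₁ , q₂) * e) + x  ≈⟨ +-congʳ (+-congˡ (trans (*-congˡ De≈1) (*-identityʳ _))) ⟩
      b + (y - x) + x                                  ≈⟨ solve 3 (λ b y x → b :+ (y :- x) :+ x := b :+ y) refl b y x ⟩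
      b + y                                            ∎

  ¬Parallel⇒lines-meet : ∀ {p q} → ¬ Parallel p q → ∀ x y →
                         ∃₂ λ s t → ((s ·V p) +V x) ≈V ((t ·V q) +V y)
  ¬Parallel⇒lines-meet ¬pq = det-invertible⇒lines-meet (proj₂ (¬Parallel⇒det-invertible ¬pq))

  multiple∈ : ∀ {P : Subset} {p v} → IsSubspace P → P p → ∃ (λ a → v ≈V (a ·V p)) → P v
  multiple∈ sP Pp (a , v≈ap) = IsSubspace.resp sP (≈V-sym v≈ap) (IsSubspace.·∈ sP a Pp)

  span⊆ : ∀ {P Q : Subset} {q} → IsSubspace P → P q →
          (∀ u → Q u → ∃ λ b → u ≈V (b ·V q)) → ∀ u → Q u → P u
  span⊆ sP Pq spanQ u Qu = multiple∈ sP Pq (spanQ u Qu)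

  coset-mono : ∀ {P Q : Subset} {x} → (∀ u → P u → Q u) → ∀ z → coset P x z → coset Q x z
  coset-mono P⊆Q z (u , Pu , z≈u+x) = u , P⊆Q u Pu , z≈u+x

  ≐-trans : ∀ {A B C : Subset} → A ≐ B → B ≐ C → A ≐ C
  ≐-trans A≐B B≐C z = (λ Az → proj₁ (B≐C z) (proj₁ (A≐B z) Az))
                    , (λ Cz → proj₂ (A≐B z) (proj₂ (B≐C z) Cz))

  Parallel⇒coset-≐ : ∀ {P Q : Subset} {p q} → IsSubspace P → IsSubspace Q →
    ¬ (p ≈V 0V) → P p → (∀ u → P u → ∃ λ a → u ≈V (a ·V p)) →
    ¬ (q ≈V 0V) → Q q → (∀ u → Q u → ∃ λ b → u ≈V (b ·V q)) →
    Parallel p q → ∀ x → coset Q x ≐ coset P x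
  Parallel⇒coset-≐ sP sQ p≉0 Pp spanP q≉0 Qq spanQ pq x z =
      coset-mono (span⊆ sP (multiple∈ sP Pp (Parallel⇒multiple p≉0 pq)) spanQ) z
    , coset-mono (span⊆ sQ (multiple∈ sQ Qq (Parallel⇒multiple q≉0 (Parallel-sym pq))) spanP) z

  coset-step : ∀ {P : Subset} {x z w} → IsSubspace P →
               coset P x z → coset P x (z +V w) → P w
  coset-step {P} {x₁ , x₂} {z₁ , z₂} {w₁ , w₂} sP (a , Pa , a₁ , a₂) (b , Pb , b₁ , b₂) =
    IsSubspace.resp sP (≈V-sym (difference a₁ b₁ , difference a₂ b₂))
      (IsSubspace.+∈ sP Pb (IsSubspace.·∈ sP (- 1#) Pa))
    where
    difference : ∀ {z w a b x} → z ≈ a + x → z + w ≈ b + x → w ≈ b + - 1# * a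
    difference {z} {w} {a} {b} {x} z≈a+x zw≈b+x = begin
      w                       ≈⟨ solve 2 (λ z w → w := z :+ w :+ :- con (+ 1) :* z) refl z w ⟩
      z + w + - 1# * z        ≈⟨ +-cong zw≈b+x (*-congˡ z≈a+x) ⟩
      b + x + - 1# * (a + x)  ≈⟨ solve 3 (λ a b x → b :+ x :+ :- con (+ 1) :* (a :+ x) := b :+ :- con (+ 1) :* a) refl a b x ⟩
      b + - 1# * a            ∎

  -- y and y + q lie on Q + y.
  coset⊆⇒generator∈ : ∀ {P Q : Subset} {q x y} → IsSubspace P → IsSubspace Q → Q q →
                      (∀ z → coset Q y z → coset P x z) → P q
  coset⊆⇒generator∈ {y = y₁ , y₂} sP sQ Qq Q+y⊆P+x =
    coset-step sP (Q+y⊆P+x _ (0V , IsSubspace.zero∈ sQ , sym (+-identityˡ y₁) , sym (+-identityˡ y₂)))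
                  (Q+y⊆P+x _ (_ , Qq , +-comm y₁ _ , +-comm y₂ _))

  coset-recentre : ∀ {P : Subset} {x y} → IsSubspace P → coset P x y → coset P x ≐ coset P y
  coset-recentre {P} {x₁ , x₂} {y₁ , y₂} sP (u , Pu , y≈u+x) (z₁ , z₂) = forward , backward
    where
    forward : coset P (x₁ , x₂) (z₁ , z₂) → coset P (y₁ , y₂) (z₁ , z₂)
    forward (v , Pv , z≈v+x) =
        v +V ((- 1#) ·V u) , IsSubspace.+∈ sP Pv (IsSubspace.·∈ sP (- 1#) Pu)
      , shift (proj₁ z≈v+x) (proj₁ y≈u+x) , shift (proj₂ z≈v+x) (proj₂ y≈u+x)
      where
      shift : ∀ {z v x y u} → z ≈ v + x → y ≈ u + x → z ≈ v + - 1# * u + y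
      shift {z} {v} {x} {y} {u} z≈v+x y≈u+x = begin
        z                       ≈⟨ z≈v+x ⟩
        v + x                   ≈⟨ solve 3 (λ v x u → v :+ x := v :+ :- con (+ 1) :* u :+ (u :+ x)) refl v x u ⟩
        v + - 1# * u + (u + x)  ≈⟨ +-congˡ (sym y≈u+x) ⟩
        v + - 1# * u + y        ∎

    backward : coset P (y₁ , y₂) (z₁ , z₂) → coset P (x₁ , x₂) (z₁ , z₂)
    backward (v , Pv , z≈v+y) =
        v +V u , IsSubspace.+∈ sP Pv Pu
      , shift (proj₁ z≈v+y) (proj₁ y≈u+x) , shift (proj₂ z≈v+y) (proj₂ y≈u+x)
      where
      shift : ∀ {z v x y u} → z ≈ v + y → y ≈ u + x → z ≈ v + u + x
      shift {z} {v} {x} {y} {u} z≈v+y y≈u+x =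
        trans z≈v+y (trans (+-congˡ y≈u+x) (sym (+-assoc v u x)))

  module Spread (k : Kind F) {i : Level} {I : Set i} (S : I → Subset) (spread : Is10Spread k S) where
    open Is10Spread spread

    directions-parallel : ∀ {j j'} {P Q : Subset} {p q x y} →
      IsSubspace P → P p → (∀ u → P u → ∃ λ a → u ≈V (a ·V p)) → S j ≐ coset P x →
      IsSubspace Q → Q q → S j' ≐ coset Q y → Parallel p q
    directions-parallel {j} {j'} {P} {Q} {p} {q} {x} {y} sP Pp spanP Sj≐ sQ Qq Sj'≐
      with Parallel? p q
    ... | yes pq = pq
    ... | no ¬pq = ⊥-elim (flats-meet (¬Parallel⇒lines-meet ¬pq x y))
      where
      same-flat⇒Parallel : j ≡.≡ j' → Parallel p q
      same-flat⇒Parallel j≡j' = uncurry multiple⇒Parallel (spanP q (coset⊆⇒generator∈ sP sQ Qq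
        (λ z → proj₁ (Sj≐ z) ∘ proj₂ (≡.subst (λ i → S i ≐ coset Q y) (≡.sym j≡j') Sj'≐ z))))

      flats-meet : (∃₂ λ s t → ((s ·V p) +V x) ≈V ((t ·V q) +V y)) → ⊥
      flats-meet (s , t , meet) = disjoint j j' (¬pq ∘ same-flat⇒Parallel) ((s ·V p) +V x)
        (proj₂ (Sj≐ _) (s ·V p , IsSubspace.·∈ sP s Pp , refl , refl))
        (proj₂ (Sj'≐ _) (t ·V q , IsSubspace.·∈ sQ t Qq , meet))

    every-flat-coset-of : ∀ {j₀ P x₀} → Is1Dim P → S j₀ ≐ coset P x₀ →
                          ∀ j → ∃ λ x → S j ≐ coset P x
    every-flat-coset-of (sP , p , p≉0 , Pp , spanP) Sj₀≐ j with flat j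
    ... | Q , (sQ , q , q≉0 , Qq , spanQ) , _ , y , Sj≐ =
      y , ≐-trans Sj≐ (Parallel⇒coset-≐ sP sQ p≉0 Pp spanP q≉0 Qq spanQ
                         (directions-parallel sP Pp spanP Sj₀≐ sQ Qq Sj≐) y)

    every-coset-flat : ∀ {P} → IsSubspace P → (∀ j → ∃ λ x → S j ≐ coset P x) →
                       ∀ x → ∃ λ j → S j ≐ coset P x
    every-coset-flat sP flats x with cover x
    ... | j , Sjx with flats j
    ...   | x' , Sj≐ = j , ≐-trans Sj≐ (coset-recentre sP (proj₁ (Sj≐ x) Sjx))

    -- cover 0V only supplies some index: any flat of the spread would do.
    spread-is-type-I : ∃ λ (P : Subset) → Is1Dim P × TotIsotropic k P
             × (∀ j → ∃ λ x → S j ≐ coset P x) × (∀ x → ∃ λ j → S j ≐ coset P x)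
    spread-is-type-I with flat (proj₁ (cover 0V))
    ... | P , dimP , isoP , _ , Sj₀≐ = P , dimP , isoP , flats , every-coset-flat (proj₁ dimP) flats
      where
      flats : ∀ j → ∃ λ x → S j ≐ coset P x
      flats = every-flat-coset-of dimP Sj₀≐

lemma4p2 : {c ℓ i : Level} (F : FiniteField c ℓ) (k : Kind F) {I : Set i}
    (S : I → Space.Subset F) → Space.Is10Spread F k S →
    ∃ λ (P : Space.Subset F) → Space.Is1Dim F P × Space.TotIsotropic F k P
    × (∀ j → ∃ λ x → Space._≐_ F (S j) (Space.coset F P x))
    × (∀ x → ∃ λ j → Space._≐_ F (S j) (Space.coset F P x))
lemma4p2 F k S spread = Plane.Spread.spread-is-type-I F k S spread
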